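{- Let $d \geq 1$ and let $\mathcal{B} = \{B_1, \dots, B_n\}$ be a $(2,3)$-agreeable arrangement of $n \geq 1$ $d$-boxes. Then some point of $\mathbb{R}^d$ lies in at least $n/(2d)$ of the boxes, i.e. the agreement proportion of $\mathcal{B}$ is at least $(2d)^{ -1}$. Equivalently, in graph form: for all integers $r \geq 1$ and $d \geq 1$, $\rho(r,d) \geq \frac{1}{2d}$.
   Context: A $d$-box is a Cartesian product of $d$ closed intervals in $\mathbb{R}^d$. An arrangement of boxes is $(2,3)$-agreeable if among any three of its boxes at least two have non-empty intersection. The agreement proportion of an arrangement of $n$ boxes is (maximal number of boxes sharing a common point)$/n$. The intersection graph of an arrangement has one vertex per box and an edge between two boxes iff they intersect. The boxicity $\mathrm{box}(G)$ of a simple graph $G$ is the smallest $d$ such that $G$ is the intersection graph of an arrangement of $d$-boxes, with the convention $\mathrm{box}(K_n)=0$. A graph is $(2,3)$-agreeable if any three vertices induce a subgraph with at least one edge. $\omega(G)$ denotes the clique number. $\mathcal{G}_d(r)$ is the set of $(2,3)$-agreeable graphs $G$ with $\mathrm{box}(G)\le d$ and $\omega(G)\le r$, and $\rho(r,d)=\min\{\omega(G)/\#V(G) : G \in \mathcal{G}_d(r)\}$ (the minimum over finitely many graphs, graphs with at least one vertex). -}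

module Defs where

open import Level using (_⊔_)
open import Data.Nat using (ℕ)
open import Data.Fin using (Fin)
open import Data.Product using (_×_; ∃)
open import Data.Sum using (_⊎_)
open import Relation.Binary.Bundles using (TotalOrder)
open import Relation.Binary.PropositionalEquality using (_≢_)

-- Coordinates live in an arbitrary total order O (e.g. the reals).
-- A d-box is a product of d closed (non-empty) intervals [lo i, hi i].
module _ {c ℓ₁ ℓ₂} (O : TotalOrder c ℓ₁ ℓ₂) where
  open TotalOrder O renaming (Carrier to X)

  record Box (d : ℕ) : Set (c ⊔ ℓ₂) where
    constructor box
    field
      lo : Fin d → X
      hi : Fin d → X
      lo≤hi : ∀ i → lo i ≤ hi i

  _∈Box_ : ∀ {d} → (Fin d → X) → Box d → Set ℓ₂
  x ∈Box B = ∀ i → (Box.lo B i ≤ x i) × (x i ≤ Box.hi B i)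

  Intersect : ∀ {d} → Box d → Box d → Set (c ⊔ ℓ₂)
  Intersect B C = ∃ λ x → (x ∈Box B) × (x ∈Box C)

  Agreeable23 : ∀ {d n} → (Fin n → Box d) → Set (c ⊔ ℓ₂)
  Agreeable23 B = ∀ i j k → i ≢ j → j ≢ k → i ≢ k →
    Intersect (B i) (B j) ⊎ Intersect (B j) (B k) ⊎ Intersect (B i) (B k)

-- For each direction k let pivot k be a box whose right end in direction k is least.  A box
-- meeting pivot k contains that right end in its k-th interval, so the boxes meeting every
-- pivot share the point whose k-th coordinate is that right end.  Every other box misses
-- some pivot, and in a (2,3)-agreeable family the boxes missing a fixed box pairwise
-- intersect, hence share a point by Helly's theorem for boxes.  The n boxes are thus covered
-- by d + 1 ≤ 2d stabbed subfamilies, and one of them has at least n / (d + 1) members.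
module Submission where

open import Defs
open import Data.Nat using (ℕ; _≤_; _*_)
open import Data.Fin using (Fin)
open import Data.Fin.Subset using (Subset; _∈_; ∣_∣)
open import Data.Product using (_×_; ∃)
open import Relation.Binary.Bundles using (TotalOrder)

open import Data.Bool using (Bool; true; false)
open import Data.Empty using (⊥-elim)
open import Data.Fin using (zero; suc; _≟_)
open import Data.Fin.Properties using (any?; all?; ¬∀⟶∃¬)
open import Data.Fin.Subset using (_∉_; ∁; ⊤; Empty; inside; outside)
open import Data.Fin.Subset.Properties using (_∈?_; ∈⊤; x∉p⇒x∈∁p; x∈∁p⇒x∉p)
open import Data.Maybe using (Maybe; just; nothing)
open import Data.Nat using (suc; s≤s; z≤n; _+_)
open import Data.Nat.Properties
  using (module ≤-Reasoning; ≤-refl; ≤-trans; ≤-reflexive; ≤-total; m≤m+n; +-suc;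
         +-mono-≤; +-monoʳ-≤; *-monoʳ-≤; *-monoˡ-≤; +-0-commutativeMonoid)
open import Data.Product using (_,_; proj₁; proj₂)
open import Data.Sum using (_⊎_; inj₁; inj₂)
open import Data.Vec using ([]; _∷_; lookup; tabulate; here; there)
open import Data.Vec.Properties using (lookup∘tabulate; []=⇒lookup; lookup⇒[]=)
open import Function using (_∘_)
open import Relation.Binary.Bundles using (TotalPreorder)
open import Relation.Binary.Core using (Rel)
open import Relation.Binary.Definitions using (Reflexive)
import Relation.Binary.Construct.Flip.EqAndOrd as Flip
open import Relation.Binary.PropositionalEquality using (_≡_; _≢_; refl; sym; trans; cong)
open import Relation.Nullary using (Dec; yes; no; does; ¬_)
open import Relation.Nullary.Decidable using (_⊎-dec_; dec-true; dec-no)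
open import Relation.Unary using (Pred; Decidable)

open import Algebra.Properties.CommutativeMonoid.Sum +-0-commutativeMonoid
  using (sum; sum-syntax; sum-remove; sum-cong-≗; ∑-comm)

private
  variable
    m n : ℕ

indicator : Bool → ℕ
indicator true = 1
indicator false = 0

∣p∣≡∑indicator : (p : Subset n) → ∣ p ∣ ≡ ∑[ i < n ] indicator (lookup p i)
∣p∣≡∑indicator [] = refl
∣p∣≡∑indicator (inside ∷ p) = cong suc (∣p∣≡∑indicator p)
∣p∣≡∑indicator (outside ∷ p) = ∣p∣≡∑indicator p

f≤sum : (f : Fin m → ℕ) (i : Fin m) → f i ≤ sum f
f≤sum {suc m} f i = ≤-trans (m≤m+n (f i) _) (≤-reflexive (sym (sum-remove f)))

n≤sum : (f : Fin n → ℕ) → (∀ i → 1 ≤ f i) → n ≤ sum f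
n≤sum {0} f f≥1 = z≤n
n≤sum {suc n} f f≥1 = +-mono-≤ (f≥1 zero) (n≤sum (f ∘ suc) (f≥1 ∘ suc))

sum≤length*max : (f : Fin (suc m) → ℕ) → ∃ λ j → sum f ≤ suc m * f j
sum≤length*max {0} f = zero , ≤-refl
sum≤length*max {suc m} f with sum≤length*max (f ∘ suc)
... | j , ∑≤ with ≤-total (f zero) (f (suc j))
...   | inj₁ f₀≤fⱼ = suc j , +-mono-≤ f₀≤fⱼ ∑≤
...   | inj₂ fⱼ≤f₀ = zero , +-monoʳ-≤ (f zero) (≤-trans ∑≤ (*-monoʳ-≤ (suc m) fⱼ≤f₀))

-- Double counting of the incidences i ∈ S j.
covering⇒n≤∑∣S∣ : (S : Fin m → Subset n) → (∀ i → ∃ λ j → i ∈ S j) → n ≤ ∑[ j < m ] ∣ S j ∣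
covering⇒n≤∑∣S∣ {m} {n} S covers = begin
  n                                                    ≤⟨ n≤sum incidences incidences≥1 ⟩
  ∑[ i < n ] ∑[ j < m ] indicator (lookup (S j) i)    ≡⟨ ∑-comm (λ i j → indicator (lookup (S j) i)) ⟩
  ∑[ j < m ] ∑[ i < n ] indicator (lookup (S j) i)    ≡⟨ sum-cong-≗ (sym ∘ ∣p∣≡∑indicator ∘ S) ⟩
  ∑[ j < m ] ∣ S j ∣                                  ∎
  where
  open ≤-Reasoning
  incidences : Fin n → ℕ
  incidences i = ∑[ j < m ] indicator (lookup (S j) i)
  incidences≥1 : ∀ i → 1 ≤ incidences i
  incidences≥1 i with covers i
  ... | j , i∈Sj = ≤-trans (≤-reflexive (cong indicator (sym ([]=⇒lookup i∈Sj))))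
                           (f≤sum (λ j → indicator (lookup (S j) i)) j)

covering-pigeonhole : (S : Fin (suc m) → Subset n) → (∀ i → ∃ λ j → i ∈ S j) →
  ∃ λ j → n ≤ suc m * ∣ S j ∣
covering-pigeonhole S covers with sum≤length*max (∣_∣ ∘ S)
... | j , ∑≤ = j , ≤-trans (covering⇒n≤∑∣S∣ S covers) ∑≤

module _ {p} {P : Pred (Fin n) p} (P? : Decidable P) where

  subset : Subset n
  subset = tabulate (does ∘ P?)

  ∈-subset⁻ : ∀ {i} → i ∈ subset → P i
  ∈-subset⁻ {i} i∈ with P? i | trans (sym (lookup∘tabulate (does ∘ P?) i)) ([]=⇒lookup i∈)
  ... | yes Pi | _  = Pi
  ... | no _   | ()

  ∈-subset⁺ : ∀ {i} → P i → i ∈ subset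
  ∈-subset⁺ {i} Pi = lookup⇒[]= i subset (trans (lookup∘tabulate (does ∘ P?) i) (dec-true (P? i) Pi))

Agreeable₂₃ : ∀ {e} → Rel (Fin n) e → Set e
Agreeable₂₃ E = ∀ i j k → i ≢ j → j ≢ k → i ≢ k → E i j ⊎ E j k ⊎ E i k

-- Adjacency is not decidable, so the neighbourhood N of a is read off the agreeability
-- oracle: u is put into N when its answer on some triple {a, u, v} is E a u.
module _ {e} {E : Rel (Fin n) e} (agree : Agreeable₂₃ E) (a : Fin n) where

  private
    ask : ∀ u v → Maybe (E a u ⊎ E u v ⊎ E a v)
    ask u v with a ≟ u | u ≟ v | a ≟ v
    ... | no a≢u | no u≢v | no a≢v = just (agree a u v a≢u u≢v a≢v)
    ... | _      | _      | _      = nothing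

    ask-distinct : ∀ {u v} (a≢u : a ≢ u) (u≢v : u ≢ v) (a≢v : a ≢ v) →
      ask u v ≡ just (agree a u v a≢u u≢v a≢v)
    ask-distinct {u} {v} a≢u u≢v a≢v
      rewrite dec-no (a ≟ u) a≢u | dec-no (u ≟ v) u≢v | dec-no (a ≟ v) a≢v = refl

    AnswersFirst AnswersLast : Fin n → Fin n → Set e
    AnswersFirst u v = ∃ λ x → ask u v ≡ just (inj₁ x)
    AnswersLast u v = ∃ λ y → ask u v ≡ just (inj₂ (inj₂ y))

    answersFirst? : ∀ u v → Dec (AnswersFirst u v)
    answersFirst? u v with ask u v
    ... | just (inj₁ x) = yes (x , refl)
    ... | just (inj₂ _) = no λ { (_ , ()) }
    ... | nothing       = no λ { (_ , ()) }

    answersLast? : ∀ u v → Dec (AnswersLast u v)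
    answersLast? u v with ask u v
    ... | just (inj₂ (inj₂ y)) = yes (y , refl)
    ... | just (inj₂ (inj₁ _)) = no λ { (_ , ()) }
    ... | just (inj₁ _)        = no λ { (_ , ()) }
    ... | nothing              = no λ { (_ , ()) }

    InNeighbourhood : Fin n → Set e
    InNeighbourhood u = a ≡ u ⊎ ∃ λ v → AnswersFirst u v ⊎ AnswersLast v u

    inNeighbourhood? : Decidable InNeighbourhood
    inNeighbourhood? u = (a ≟ u) ⊎-dec any? (λ v → answersFirst? u v ⊎-dec answersLast? v u)

  nonNeighbours-clique : Reflexive E →
    ∃ λ (N : Subset n) → (∀ {u} → u ∈ N → E a u) × (∀ {u v} → u ∉ N → v ∉ N → E u v)
  nonNeighbours-clique E-refl = N , adjacent , clique
    where
    N : Subset n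
    N = subset inNeighbourhood?

    adjacent : ∀ {u} → u ∈ N → E a u
    adjacent u∈N with ∈-subset⁻ inNeighbourhood? u∈N
    ... | inj₁ refl                     = E-refl
    ... | inj₂ (_ , inj₁ (Eau , _))     = Eau
    ... | inj₂ (_ , inj₂ (Eau , _))     = Eau

    outside-N : ∀ {u} → u ∉ N → ¬ InNeighbourhood u
    outside-N u∉N = u∉N ∘ ∈-subset⁺ inNeighbourhood?

    clique : ∀ {u v} → u ∉ N → v ∉ N → E u v
    clique {u} {v} u∉N v∉N with u ≟ v
    ... | yes refl = E-refl
    ... | no u≢v with agree a u v a≢u u≢v a≢v | ask-distinct a≢u u≢v a≢v
      where
      a≢u : a ≢ u
      a≢u = outside-N u∉N ∘ inj₁
      a≢v : a ≢ v
      a≢v = outside-N v∉N ∘ inj₁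
    ... | inj₁ Eau        | asked = ⊥-elim (outside-N u∉N (inj₂ (v , inj₁ (Eau , asked))))
    ... | inj₂ (inj₁ Euv) | _     = Euv
    ... | inj₂ (inj₂ Eav) | asked = ⊥-elim (outside-N v∉N (inj₂ (u , inj₂ (Eav , asked))))

module _ {a ℓ₁ ℓ₂} (P : TotalPreorder a ℓ₁ ℓ₂) where
  open TotalPreorder P using (Carrier; _≲_)
    renaming (refl to ≲-refl; trans to ≲-trans; total to ≲-total)

  maximum-on : (f : Fin n → Carrier) (S : Subset n) →
    Empty S ⊎ ∃ λ m → m ∈ S × (∀ {i} → i ∈ S → f i ≲ f m)
  maximum-on f [] = inj₁ λ ()
  maximum-on f (s ∷ S) with s | maximum-on (f ∘ suc) S
  ... | outside | inj₁ empty = inj₁ λ { (suc i , there i∈S) → empty (i , i∈S) }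
  ... | outside | inj₂ (m , m∈S , max) = inj₂ (suc m , there m∈S , λ { (there i∈S) → max i∈S })
  ... | inside  | inj₁ empty =
    inj₂ (zero , here , λ { here → ≲-refl ; (there i∈S) → ⊥-elim (empty (_ , i∈S)) })
  ... | inside  | inj₂ (m , m∈S , max) with ≲-total (f zero) (f (suc m))
  ...   | inj₁ f₀≲fₘ = inj₂ (suc m , there m∈S , λ { here → f₀≲fₘ ; (there i∈S) → max i∈S })
  ...   | inj₂ fₘ≲f₀ =
    inj₂ (zero , here , λ { here → ≲-refl ; (there i∈S) → ≲-trans (max i∈S) fₘ≲f₀ })

minimum : ∀ {a ℓ₁ ℓ₂} (P : TotalPreorder a ℓ₁ ℓ₂) (f : Fin (suc n) → TotalPreorder.Carrier P) →
  ∃ λ m → ∀ i → TotalPreorder._≲_ P (f m) (f i)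
minimum P f with maximum-on (Flip.totalPreorder P) f ⊤
... | inj₁ empty         = ⊥-elim (empty (zero , ∈⊤))
... | inj₂ (m , _ , min) = m , λ i → min ∈⊤

module _ {c ℓ₁ ℓ₂} (O : TotalOrder c ℓ₁ ℓ₂) {d : ℕ} where
  open TotalOrder O using (totalPreorder)
    renaming (Carrier to X; _≤_ to _≼_; refl to ≼-refl; trans to ≼-trans)
  open Box

  Intersect-refl : Reflexive (Intersect O {d})
  Intersect-refl {B} = lo B , lo∈B , lo∈B
    where
    lo∈B : _∈Box_ O (lo B) B
    lo∈B k = ≼-refl , lo≤hi B k

  Intersect⇒lo≤hi : ∀ {B C : Box O d} → Intersect O B C → ∀ k → lo C k ≼ hi B k
  Intersect⇒lo≤hi (x , x∈B , x∈C) k = ≼-trans (proj₁ (x∈C k)) (proj₂ (x∈B k))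

  -- Helly's theorem for boxes: coordinatewise, the largest left end lies in every interval.
  pairwise-intersecting⇒common-point : (B : Fin (suc n) → Box O d) (S : Subset (suc n)) →
    (∀ {i j} → i ∈ S → j ∈ S → Intersect O (B i) (B j)) → ∃ λ x → ∀ {i} → i ∈ S → _∈Box_ O x (B i)
  pairwise-intersecting⇒common-point B S pairwise =
    proj₁ ∘ coordinate , λ i∈S k → proj₂ (coordinate k) i∈S
    where
    coordinate : ∀ k → ∃ λ t → ∀ {i} → i ∈ S → lo (B i) k ≼ t × t ≼ hi (B i) k
    coordinate k with maximum-on totalPreorder (λ i → lo (B i) k) S
    ... | inj₁ empty           = lo (B zero) k , λ i∈S → ⊥-elim (empty (_ , i∈S))
    ... | inj₂ (m , m∈S , max) =
      lo (B m) k , λ {i} i∈S → max i∈S , Intersect⇒lo≤hi {B i} {B m} (pairwise i∈S m∈S) k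

  module _ (B : Fin (suc n) → Box O d) (agree : Agreeable23 O B) where

    meets-refl : Reflexive (λ i j → Intersect O (B i) (B j))
    meets-refl {i} = Intersect-refl {B i}

    pivot : Fin d → Fin (suc n)
    pivot k = proj₁ (minimum totalPreorder (λ i → hi (B i) k))

    corner : Fin d → X
    corner k = hi (B (pivot k)) k

    meets-pivot⇒contains-corner : ∀ {k u} → Intersect O (B (pivot k)) (B u) →
      lo (B u) k ≼ corner k × corner k ≼ hi (B u) k
    meets-pivot⇒contains-corner {k} {u} meets =
      Intersect⇒lo≤hi {B (pivot k)} {B u} meets k , proj₂ (minimum totalPreorder (λ i → hi (B i) k)) u

    neighbours : Fin d → Subset (suc n)
    neighbours k = proj₁ (nonNeighbours-clique agree (pivot k) meets-refl)

    neighbours-meet-pivot : ∀ {k u} → u ∈ neighbours k → Intersect O (B (pivot k)) (B u)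
    neighbours-meet-pivot {k} = proj₁ (proj₂ (nonNeighbours-clique agree (pivot k) meets-refl))

    non-neighbours-intersect : ∀ {k u v} → u ∉ neighbours k → v ∉ neighbours k →
      Intersect O (B u) (B v)
    non-neighbours-intersect {k} = proj₂ (proj₂ (nonNeighbours-clique agree (pivot k) meets-refl))

    NeighbourOfAllPivots : Fin (suc n) → Set
    NeighbourOfAllPivots u = ∀ k → u ∈ neighbours k

    neighbourOfAllPivots? : Decidable NeighbourOfAllPivots
    neighbourOfAllPivots? u = all? (λ k → u ∈? neighbours k)

    family : Fin (suc d) → Subset (suc n)
    family zero    = subset neighbourOfAllPivots?
    family (suc k) = ∁ (neighbours k)

    family-covers : ∀ u → ∃ λ j → u ∈ family j
    family-covers u with neighbourOfAllPivots? u
    ... | yes u∈all = zero , ∈-subset⁺ neighbourOfAllPivots? u∈all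
    ... | no u∉all with ¬∀⟶∃¬ d _ (λ k → u ∈? neighbours k) u∉all
    ...   | k , u∉N = suc k , x∉p⇒x∈∁p u∉N

    family-stabbed : ∀ j → ∃ λ x → ∀ {u} → u ∈ family j → _∈Box_ O x (B u)
    family-stabbed zero    = corner , λ u∈all k →
      meets-pivot⇒contains-corner (neighbours-meet-pivot (∈-subset⁻ neighbourOfAllPivots? u∈all k))
    family-stabbed (suc k) = pairwise-intersecting⇒common-point B (∁ (neighbours k)) λ u∈ v∈ →
      non-neighbours-intersect (x∈∁p⇒x∉p u∈) (x∈∁p⇒x∉p v∈)

    large-stabbed-subfamily :
      ∃ λ x → ∃ λ S → (∀ {u} → u ∈ S → _∈Box_ O x (B u)) × suc n ≤ suc d * ∣ S ∣
    large-stabbed-subfamily =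
      let j , n≤ = covering-pigeonhole family family-covers
          x , x∈ = family-stabbed j
      in x , family j , x∈ , n≤

suc≤2* : ∀ {d} → 1 ≤ d → suc d ≤ 2 * d
suc≤2* {suc d} _ = s≤s (≤-trans (m≤m+n (suc d) (d + 0)) (≤-reflexive (sym (+-suc d (d + 0)))))

theorem1p1 : ∀ {c ℓ₁ ℓ₂} (O : TotalOrder c ℓ₁ ℓ₂) (d n : ℕ) → 1 ≤ d → 1 ≤ n →
    (B : Fin n → Box O d) → Agreeable23 O B →
    ∃ λ (x : Fin d → TotalOrder.Carrier O) → ∃ λ (S : Subset n) →
      (∀ i → i ∈ S → _∈Box_ O x (B i)) × (n ≤ 2 * d * ∣ S ∣)
theorem1p1 O d (suc n) 1≤d _ B agree =
  let x , S , x∈S⇒x∈B , n≤ = large-stabbed-subfamily O B agree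
  in x , S , (λ _ → x∈S⇒x∈B) , ≤-trans n≤ (*-monoˡ-≤ ∣ S ∣ (suc≤2* 1≤d))
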